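{- Let $k\geq0$, let $i=2^k+j$ with $1\le j<2^k$, and let $n\geq k$. Then $S[\mathcal A^{n+1}_i]$ is isomorphic to $\mathcal A^{k+1}_j$, and $S[\mathcal B^{n+1}_i]$ is isomorphic to $\mathcal B^{k+1}_j$.
   Context: Models considered are finite Kripke models $(W,R,V)$ with $R$ transitive and irreflexive, whose frame is a tree, equipped with a partial successor function $S$ sending some points to one of their daughters. For a rooted such model $\mathcal M$ with root $w_0$, $S[\mathcal M]$ is the submodel generated by $S(w_0)$ (that point with all its $R$-successors, with $R,V,S$ restricted). Adding a fresh root to a model $Z$ means adding a new irreflexive point that $R$-sees every point of $Z$ and satisfies no variable. For $n\geq1$ and $1\le i\le2^n$, models $\mathcal A^n_i,\mathcal B^n_i$ with roots $a^n_i,b^n_i$ are defined by recursion: for every $n\geq0$, (i) if $i\le2^n$: when $n=0$, $\mathcal A^1_1$ is a single point where exactly $p_1$ is true and $\mathcal B^1_1$ a single point where no variable is true (empty $S$); when $n\ge1$, $\mathcal A^{n+1}_i$ (resp. $\mathcal B^{n+1}_i$) is a copy of $\mathcal A^n_i$ (resp. $\mathcal B^n_i$), same $S$, with $p_{n+1}$ additionally true at the root. (ii) if $i=2^n+j$, $1\le j\le2^n$: $\mathcal B^{n+1}_{2^n+j}$ is obtained by adding a fresh root $b$ to $\bigsqcup_{k=2}^{2^n}S[\mathcal A^{n+1}_k]\sqcup\mathcal B^{n+1}_j$, with successor function $S_{\mathcal B^{n+1}_j}\cup\{(b,b^{n+1}_j)\}$; $\mathcal A^{n+1}_{2^n+j}$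 is obtained by adding a fresh root $a$ to $\bigsqcup_{k=2}^{2^n}S[\mathcal A^{n+1}_k]\sqcup\mathcal B^{n+1}_j\sqcup\mathcal A^{n+1}_j$, with successor function $S_{\mathcal A^{n+1}_j}\cup\{(a,a^{n+1}_j)\}$ (for $n=0$ the union over $k$ is empty). Isomorphism means a bijection preserving the relation and the valuation. -}

module Defs where

open import Data.Nat using (ℕ; zero; suc; _+_; _∸_; _^_; _≤ᵇ_; _≡ᵇ_)
open import Data.Bool using (Bool; true; false; if_then_else_; _∨_)
open import Data.List using (List; []; _∷_; _++_; length; lookup; map; upTo)
open import Data.Fin using (Fin; zero; suc)
open import Data.Maybe using (Maybe; just; nothing)
open import Data.Product using (Σ; _×_; _,_; proj₁; proj₂)
open import Function.Bundles using (_⤖_; _⇔_; Bijection)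
open import Relation.Binary.PropositionalEquality using (_≡_)

-- A finite tree-shaped model: valuation at the root (variable p_m is index m),
-- list of daughters, and the successor S at the root (an index of a daughter, or undefined).
data Tree : Set where
  node : (v : ℕ → Bool) (cs : List Tree) → Maybe (Fin (length cs)) → Tree

data Pos : Tree → Set where
  here  : ∀ {t} → Pos t
  there : ∀ {v cs s} (k : Fin (length cs)) → Pos (lookup cs k) → Pos (node v cs s)

-- The accessibility relation R: strict descendant.
data R : (t : Tree) → Pos t → Pos t → Set where
  root< : ∀ {v cs s k p} → R (node v cs s) here (there k p)
  step  : ∀ {v cs s k p q} → R (lookup cs k) p q → R (node v cs s) (there k p) (there k q)

val : (t : Tree) → Pos t → ℕ → Bool
val (node v cs s) here m = v m
val (node v cs s) (there k p) m = val (lookup cs k) p m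

-- S[M]: the submodel generated by S(root). (Junk value M if S is undefined at the root;
-- it is never used in that case.)
Sub : Tree → Tree
Sub (node v cs (just k)) = lookup cs k
Sub (node v cs nothing)  = node v cs nothing

Iso : Tree → Tree → Set
Iso t u = Σ (Pos t ⤖ Pos u) λ f →
  (∀ p q → R t p q ⇔ R u (Bijection.to f p) (Bijection.to f q)) ×
  (∀ p m → val u (Bijection.to f p) m ≡ val t p m)

addVar : ℕ → Tree → Tree
addVar m (node v cs s) = node (λ x → (x ≡ᵇ m) ∨ v x) cs s

noVar : ℕ → Bool
noVar _ = false

onlyP1 : ℕ → Bool
onlyP1 x = x ≡ᵇ 1

-- the list [2, 3, ..., 2^n]
range2 : ℕ → List ℕ
range2 n = map (2 +_) (upTo (2 ^ n ∸ 1))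

mapPair : (Tree → Tree) → Tree × Tree → Tree × Tree
mapPair f (a , b) = (f a , f b)

mutual
  -- AB n i = (A^{n+1}_i , B^{n+1}_i)   (junk outside 1 ≤ i ≤ 2^{n+1})
  AB : ℕ → ℕ → Tree × Tree
  AB n i = if i ≤ᵇ 2 ^ n then low n i else high n (i ∸ 2 ^ n)

  -- clause (i): indices i ≤ 2^n at level n+1
  low : ℕ → ℕ → Tree × Tree
  low zero i = (node onlyP1 [] nothing , node noVar [] nothing)
  low (suc n) i = mapPair (addVar (suc (suc n))) (AB n i)

  -- clause (ii): index 2^n + j at level n+1 (distinguished daughter listed first)
  high : ℕ → ℕ → Tree × Tree
  high n j =
    ( node noVar (proj₁ (low n j) ∷ proj₂ (low n j) ∷ rest) (just zero)
    , node noVar (proj₂ (low n j) ∷ rest) (just zero) )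
    where
    rest : List Tree
    rest = map (λ k → Sub (proj₁ (low n k))) (range2 n)

𝒜 : ℕ → ℕ → Tree
𝒜 n i = proj₁ (AB n i)

ℬ : ℕ → ℕ → Tree
ℬ n i = proj₂ (AB n i)

module Submission where

-- Raising the level of 𝒜/ℬ from n+1 to n+2 keeps an index
-- i ≤ 2^(n+1) in clause (i), which only makes p_(n+2) true at the root; the
-- daughters and the successor S at the root are untouched.  Hence, once an
-- index i ≤ 2^(k+1) exists at level k+1, the models 𝒜^(n+1)_i and ℬ^(n+1)_i
-- for n ≥ k agree with 𝒜^(k+1)_i and ℬ^(k+1)_i "below the root" (`stable`),
-- and so have the same S-generated submodel whenever S is defined at the
-- root (`Sub-≈ʳ`).  For i = 2^k + j the models at level k+1 come from
-- clause (ii) (`AB-high-level`), whose distinguished daughter is literally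
-- 𝒜^(k+1)_j resp. ℬ^(k+1)_j.  So S[𝒜^(n+1)_i] and 𝒜^(k+1)_j are equal
-- trees, hence isomorphic, and likewise for ℬ.

open import Defs
open import Data.Nat using (ℕ; suc; _+_; _∸_; _^_; _≤_; _<_; s≤s; _≤′_; ≤′-refl; ≤′-step)
open import Data.Nat.Properties
  using (≤-trans; <⇒≤; <⇒≱; ≤ᵇ⇒≤; ≤⇒≤ᵇ; ≤⇒≤′; ≤′⇒≤; m<m+n; m+n∸m≡n; +-monoʳ-≤; +-identityʳ; ^-monoʳ-≤)
open import Data.Bool using (true; false; if_then_else_; T)
open import Data.List using (lookup)
open import Data.Maybe using (just)
open import Data.Product using (_×_; _,_; proj₁; proj₂)
open import Function using (id)
open import Function.Bundles using (mk⇔)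
open import Function.Construct.Identity using (⤖-id)
open import Relation.Nullary using (¬_)
open import Relation.Binary.PropositionalEquality using (_≡_; refl; sym; trans; cong; subst)

≡⇒Iso : ∀ {t u} → t ≡ u → Iso t u
≡⇒Iso {t} refl = ⤖-id (Pos t) , (λ p q → mk⇔ id id) , (λ p m → refl)

if-true : ∀ {A : Set} {b} {x y : A} → T b → (if b then x else y) ≡ x
if-true {b = true} _ = refl

if-false : ∀ {A : Set} {b} {x y : A} → ¬ T b → (if b then x else y) ≡ y
if-false {b = false} _ = refl
if-false {b = true}  ¬t with () ← ¬t _

AB-low : ∀ {n i} → i ≤ 2 ^ n → AB n i ≡ low n i
AB-low i≤ = if-true (≤⇒≤ᵇ i≤)

AB-high : ∀ {n i} → 2 ^ n < i → AB n i ≡ high n (i ∸ 2 ^ n)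
AB-high {n} {i} 2ⁿ<i = if-false (λ i≤ᵇ → <⇒≱ 2ⁿ<i (≤ᵇ⇒≤ i (2 ^ n) i≤ᵇ))

AB-lift : ∀ {n i} → i ≤ 2 ^ suc n →
  𝒜 (suc n) i ≡ addVar (2 + n) (𝒜 n i) × ℬ (suc n) i ≡ addVar (2 + n) (ℬ n i)
AB-lift i≤ = cong proj₁ (AB-low i≤) , cong proj₂ (AB-low i≤)

data _≈ʳ_ : Tree → Tree → Set where
  reval : ∀ {v w cs s} → node v cs s ≈ʳ node w cs s

≈ʳ-refl : ∀ t → t ≈ʳ t
≈ʳ-refl (node v cs s) = reval

≈ʳ-trans : ∀ {t u r} → t ≈ʳ u → u ≈ʳ r → t ≈ʳ r
≈ʳ-trans reval reval = reval

addVar-≈ʳ : ∀ m t → addVar m t ≈ʳ t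
addVar-≈ʳ m (node v cs s) = reval

addVar-≈ʳ-trans : ∀ {t u r m} → t ≡ addVar m u → u ≈ʳ r → t ≈ʳ r
addVar-≈ʳ-trans {u = u} {m = m} refl u≈r = ≈ʳ-trans (addVar-≈ʳ m u) u≈r

Sub-≈ʳ : ∀ {t v cs x} → t ≈ʳ node v cs (just x) → Sub t ≡ lookup cs x
Sub-≈ʳ reval = refl

index-bound : ∀ {k j} → j ≤ 2 ^ k → 2 ^ k + j ≤ 2 ^ suc k
index-bound {k} {j} j≤2ᵏ =
  subst (2 ^ k + j ≤_) (cong (2 ^ k +_) (sym (+-identityʳ (2 ^ k)))) (+-monoʳ-≤ (2 ^ k) j≤2ᵏ)

-- Stability: an index i ≤ 2^(k+1) of level k+1 stays in clause (i) at every
-- higher level n+1, so 𝒜^(n+1)_i and ℬ^(n+1)_i agree with 𝒜^(k+1)_i and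
-- ℬ^(k+1)_i below the root.
stable : ∀ {k n i} → k ≤ n → i ≤ 2 ^ suc k → 𝒜 n i ≈ʳ 𝒜 k i × ℬ n i ≈ʳ ℬ k i
stable {k} {i = i} k≤n i≤ = go (≤⇒≤′ k≤n)
  where
  go : ∀ {n} → k ≤′ n → 𝒜 n i ≈ʳ 𝒜 k i × ℬ n i ≈ʳ ℬ k i
  go ≤′-refl = ≈ʳ-refl (𝒜 k i) , ≈ʳ-refl (ℬ k i)
  go {suc n} (≤′-step k≤′n) =
      addVar-≈ʳ-trans (proj₁ lift) (proj₁ (go k≤′n))
    , addVar-≈ʳ-trans (proj₂ lift) (proj₂ (go k≤′n))
    where
    -- i is still in clause (i) at level n+2, since i ≤ 2^(k+1) ≤ 2^(n+1)
    lift : 𝒜 (suc n) i ≡ addVar (2 + n) (𝒜 n i) × ℬ (suc n) i ≡ addVar (2 + n) (ℬ n i)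
    lift = AB-lift (≤-trans i≤ (^-monoʳ-≤ 2 (s≤s (≤′⇒≤ k≤′n))))

AB-high-level : ∀ {k j} → 1 ≤ j → AB k (2 ^ k + j) ≡ high k j
AB-high-level {k} {j} 1≤j =
  trans (AB-high (m<m+n (2 ^ k) 1≤j)) (cong (high k) (m+n∸m≡n (2 ^ k) j))

lemma7p7 : (k j n : ℕ) → 1 ≤ j → j < 2 ^ k → k ≤ n →
    Iso (Sub (𝒜 n (2 ^ k + j))) (𝒜 k j) × Iso (Sub (ℬ n (2 ^ k + j))) (ℬ k j)
lemma7p7 k j n 1≤j j<2ᵏ k≤n =
    ≡⇒Iso (trans (Sub-≈ʳ 𝒜≈high) (cong proj₁ (sym (AB-low j≤2ᵏ))))
  , ≡⇒Iso (trans (Sub-≈ʳ ℬ≈high) (cong proj₂ (sym (AB-low j≤2ᵏ))))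
  where
  i : ℕ
  i = 2 ^ k + j

  j≤2ᵏ : j ≤ 2 ^ k
  j≤2ᵏ = <⇒≤ j<2ᵏ

  -- below the root, level n+1 agrees with level k+1, which is clause (ii)
  level-k : 𝒜 n i ≈ʳ 𝒜 k i × ℬ n i ≈ʳ ℬ k i
  level-k = stable k≤n (index-bound {k} j≤2ᵏ)

  𝒜≈high : 𝒜 n i ≈ʳ proj₁ (high k j)
  𝒜≈high = subst (𝒜 n i ≈ʳ_) (cong proj₁ (AB-high-level {k} 1≤j)) (proj₁ level-k)

  ℬ≈high : ℬ n i ≈ʳ proj₂ (high k j)
  ℬ≈high = subst (ℬ n i ≈ʳ_) (cong proj₂ (AB-high-level {k} 1≤j)) (proj₂ level-k)
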